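{- Let $\mathbf H$ be a commutative and cocommutative connected Hopf monoid linearized in the basis $\mathbf h$, $I$ a finite set and $x,y\in\mathbf h[I]$. If $A$ and $\Lambda$ are two minimal elements of $\mathcal C_x^y$ under refinement, then $A$ is obtained from $\Lambda$ by a permutation of its parts. Conversely, any set composition obtained by permuting the parts of $\Lambda$ belongs to $\mathcal C_x^y$ and is minimal.
   Context: Work over a field of characteristic $0$. A connected Hopf monoid in vector species $\mathbf H$ has products $\mu_{A_1,A_2}:\mathbf H[A_1]\otimes\mathbf H[A_2]\to\mathbf H[I]$ and coproducts $\Delta_{A_1,A_2}:\mathbf H[I]\to\mathbf H[A_1]\otimes\mathbf H[A_2]$ for ordered decompositions $I=A_1\sqcup A_2$, satisfying associativity, coassociativity and compatibility axioms; it is commutative if $\mu_{A_2,A_1}\circ\tau=\mu_{A_1,A_2}$ and cocommutative if $\tau\circ\Delta_{A_1,A_2}=\Delta_{A_2,A_1}$ ($\tau$ the swap of tensor factors). It is linearized in the basis $\mathbf h$ if products send basis pairs to basis elements and coproducts send basis elements to $0$ or to a tensor of basis elements. A set composition $A=(A_1,\dots,A_k)\models I$ is a sequence of nonempty disjoint subsets with union $I$; $\mu_A,\Delta_A$ are the iterated product/coproduct. $A\le B$ ($A$ refines $B$) if every part of $B$ is a union of consecutive parts of $A$. For $x\in\mathbf h[I]$ and $A\models I$ with $\Delta_A(x)\ne0$ put $x_A=\mu_A\Delta_A(x)\in\mathbf h[I]$, and $\mathcal C_x^y=\{A\models I:\Delta_A(x)\ne0,\ x_A=y\}$. -}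

module Defs where

open import Data.Nat using (ℕ; suc)
open import Data.Bool using (Bool; true; false)
open import Data.Vec using (Vec; []; _∷_)
open import Data.Fin.Subset using (Subset; _∪_; ⊥; Nonempty)
open import Data.List using (List; []; _∷_; _++_; foldr)
open import Data.List.Relation.Unary.All using (All; []; _∷_)
open import Data.List.Relation.Binary.Permutation.Propositional using (_↭_)
open import Data.Maybe using (Maybe; just; nothing; _>>=_) renaming (map to mapM)
open import Data.Product using (Σ; ∃; _×_; _,_; proj₁; proj₂)
open import Relation.Binary.PropositionalEquality using (_≡_)

-- Where a point of I goes in an ordered decomposition I = A ⊔ B.
data Split : Bool → Bool → Bool → Set where
  inL : Split true true false
  inR : Split true false true
  out : Split false false false

-- Decomp I A B : I = A ⊔ B (ordered decomposition; A or B may be empty).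
data Decomp : {n : ℕ} → Subset n → Subset n → Subset n → Set where
  []  : Decomp [] [] []
  _∷_ : ∀ {n i a b} {I A B : Subset n} →
        Split i a b → Decomp I A B → Decomp (i ∷ I) (a ∷ A) (b ∷ B)

data Null : {n : ℕ} → Subset n → Set where
  []  : Null []
  _∷_ : ∀ {n} {E : Subset n} → Null E → Null (false ∷ E)

-- A connected, commutative and cocommutative Hopf monoid, linearized in the
-- basis h, restricted to subsets of the finite ground set Fin n.
-- mu d a b  : product of basis elements (always a basis element).
-- cop d x   : coproduct of a basis element: nothing (= 0) or just (a , b) (= a ⊗ b).
record LinHopf (n : ℕ) : Set₁ where
  field
    h    : Subset n → Set
    mu   : ∀ {I A B} → Decomp I A B → h A → h B → h I
    cop  : ∀ {I A B} → Decomp I A B → h I → Maybe (h A × h B)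
    unit : ∀ {E} → Null E → h E
    connected : ∀ {E} (e : Null E) (z : h E) → z ≡ unit e
    assoc : ∀ {I A B C AB BC}
      (d1 : Decomp I A BC) (d2 : Decomp BC B C)
      (d3 : Decomp I AB C) (d4 : Decomp AB A B)
      (a : h A) (b : h B) (c : h C) →
      mu d1 a (mu d2 b c) ≡ mu d3 (mu d4 a b) c
    unitˡ : ∀ {I E} (e : Null E) (d : Decomp I E I) (x : h I) → mu d (unit e) x ≡ x
    unitʳ : ∀ {I E} (e : Null E) (d : Decomp I I E) (x : h I) → mu d x (unit e) ≡ x
    coassoc : ∀ {I A B C AB BC}
      (d1 : Decomp I A BC) (d2 : Decomp BC B C)
      (d3 : Decomp I AB C) (d4 : Decomp AB A B)
      (x : h I) →
      (cop d1 x >>= λ p → mapM (λ q → proj₁ p , proj₁ q , proj₂ q) (cop d2 (proj₂ p)))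
      ≡ (cop d3 x >>= λ p → mapM (λ q → proj₁ q , proj₂ q , proj₂ p) (cop d4 (proj₁ p)))
    counitˡ : ∀ {I E} (e : Null E) (d : Decomp I E I) (x : h I) → cop d x ≡ just (unit e , x)
    counitʳ : ∀ {I E} (e : Null E) (d : Decomp I I E) (x : h I) → cop d x ≡ just (x , unit e)
    compat : ∀ {I A B S T AS AT BS BT}
      (dAB : Decomp I A B) (dST : Decomp I S T)
      (dA : Decomp A AS AT) (dB : Decomp B BS BT)
      (dS : Decomp S AS BS) (dT : Decomp T AT BT)
      (a : h A) (b : h B) →
      cop dST (mu dAB a b)
      ≡ (cop dA a >>= λ p → cop dB b >>= λ q →
           just (mu dS (proj₁ p) (proj₁ q) , mu dT (proj₂ p) (proj₂ q)))
    comm : ∀ {I A B} (d : Decomp I A B) (d' : Decomp I B A) (a : h A) (b : h B) →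
      mu d a b ≡ mu d' b a
    cocomm : ∀ {I A B} (d : Decomp I A B) (d' : Decomp I B A) (x : h I) →
      cop d' x ≡ mapM (λ p → proj₂ p , proj₁ p) (cop d x)

-- IsSetComp I As : the list As = (A₁,…,A_k) is a set composition of I
-- (nonempty, pairwise disjoint parts with union I), presented as
-- I = A₁ ⊔ (A₂ ⊔ (… ⊔ A_k)).
data IsSetComp {n : ℕ} : Subset n → List (Subset n) → Set where
  nil  : ∀ {I} → Null I → IsSetComp I []
  cons : ∀ {I A J As} → Decomp I A J → Nonempty A → IsSetComp J As →
         IsSetComp I (A ∷ As)

module _ {n : ℕ} (H : LinHopf n) where
  open LinHopf H

  muIt : ∀ {I As} → IsSetComp I As → All h As → h I
  muIt (nil e) [] = unit e
  muIt (cons d _ s) (a ∷ t) = mu d a (muIt s t)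

  copIt : ∀ {I As} → IsSetComp I As → h I → Maybe (All h As)
  copIt (nil e) x = just []
  copIt (cons d _ s) x = cop d x >>= λ p → mapM (proj₁ p ∷_) (copIt s (proj₂ p))

  -- As ∈ C_x^y : As ⊨ I, Δ_As(x) ≠ 0 and x_As = μ_As Δ_As (x) = y
  InC : ∀ {I} → h I → h I → List (Subset n) → Set
  InC {I} x y As = Σ (IsSetComp I As) λ s → ∃ λ t → copIt s x ≡ just t × muIt s t ≡ y

-- Refines As Bs : As ≤ Bs, every part of Bs is the union of a (nonempty)
-- block of consecutive parts of As.
data Refines {n : ℕ} : List (Subset n) → List (Subset n) → Set where
  []  : Refines [] []
  grp : ∀ {C Cs B As Bs} → B ≡ foldr _∪_ ⊥ (C ∷ Cs) → Refines As Bs →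
        Refines ((C ∷ Cs) ++ As) (B ∷ Bs)

Minimal : ∀ {n} (H : LinHopf n) {I} → LinHopf.h H I → LinHopf.h H I → List (Subset n) → Set
Minimal {n} H x y As = InC H x y As × (∀ Bs → InC H x y Bs → Refines Bs As → Bs ≡ As)

module Submission where

-- Since H is commutative and cocommutative, adjacent factors of μ_A Δ_A(x) can be swapped, so
-- C_x^y and its minimal elements are closed under permuting parts. Let B be a part of a minimal
-- Λ and C a part of some A ∈ C_x^y meeting B; bring both to the front, so that
-- y = μ_{B,I∖B}(b, …) = μ_{C,I∖C}(c, …) with b the factor of x on B. Applying Δ_{C,I∖C} and then
-- Δ_{B,I∖B}, compatibility gives b = μ Δ_{B∩C,B∖C}(b). If B ∖ C were nonempty, coassociativity
-- would make (B ∩ C, B ∖ C, rest of Λ) a strictly finer element of C_x^y than Λ. So B ⊆ C, and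
-- B = C if A is minimal too: two minimal elements have the same parts, hence are permutations
-- of each other.

open import Defs
open import Data.Nat using (ℕ; zero; suc; _≤_; z≤n; s≤s)
open import Data.Nat.Properties using (≤-trans; ≤-reflexive; m≤n+m; suc-injective; 1+n≰n; 1+n≢n)
open import Data.Fin.Subset using (Subset; _∪_; ⊥; Nonempty; _∈_; _⊆_)
open import Data.Fin.Subset.Properties using (⊆-antisym; ∪-identityʳ; p⊆p∪q; q⊆p∪q; x∈p∪q⁻)
open import Data.Bool using (true; false)
open import Data.Vec using ([]; _∷_; here; there)
open import Data.List using (List; []; _∷_; _++_; length)
open import Data.List.Properties using (length-++; ∷-injectiveʳ)
open import Data.List.Membership.Propositional using () renaming (_∈_ to _∈ₗ_)
open import Data.List.Membership.Propositional.Properties using (∈-∃++)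
open import Data.List.Membership.Propositional.Properties.WithK using (unique∧set⇒bag)
open import Data.List.Relation.Unary.Any using (here; there)
open import Data.List.Relation.Unary.All using (_∷_; tabulate)
open import Data.List.Relation.Unary.Unique.Propositional using (Unique; []; _∷_)
open import Data.List.Relation.Binary.BagAndSetEquality using (∼bag⇒↭)
open import Data.List.Relation.Binary.Permutation.Propositional
  using (_↭_; refl; prep; swap; ↭-sym) renaming (trans to ↭-trans)
open import Data.List.Relation.Binary.Permutation.Propositional.Properties
  using (++⁺ˡ; shifts; shift; ↭-length)
open import Data.Maybe using (Maybe; just; _>>=_) renaming (map to mapM)
open import Data.Maybe.Properties using (just-injective)
open import Data.Product using (Σ; ∃; ∃₂; _×_; _,_; proj₁; proj₂)
open import Data.Sum using (_⊎_; inj₁; inj₂; [_,_]′)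
open import Data.Empty using (⊥-elim) renaming (⊥ to Empty)
open import Function using (_∘′_)
open import Function.Bundles using (mk⇔)
open import Relation.Binary.PropositionalEquality

-- Ordered decompositions I = A ⊔ B

Split-sym : ∀ {i a b} → Split i a b → Split i b a
Split-sym inL = inR
Split-sym inR = inL
Split-sym out = out

Decomp-sym : ∀ {n} {I A B : Subset n} → Decomp I A B → Decomp I B A
Decomp-sym [] = []
Decomp-sym (s ∷ d) = Split-sym s ∷ Decomp-sym d

Decomp⇒∪ : ∀ {n} {I A B : Subset n} → Decomp I A B → I ≡ A ∪ B
Decomp⇒∪ [] = refl
Decomp⇒∪ (inL ∷ d) = cong (true ∷_) (Decomp⇒∪ d)
Decomp⇒∪ (inR ∷ d) = cong (true ∷_) (Decomp⇒∪ d)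
Decomp⇒∪ (out ∷ d) = cong (false ∷_) (Decomp⇒∪ d)

Decomp⇒⊆ˡ : ∀ {n} {I A B : Subset n} → Decomp I A B → A ⊆ I
Decomp⇒⊆ˡ {B = B} d p∈A rewrite Decomp⇒∪ d = p⊆p∪q B p∈A

Decomp⇒⊆ʳ : ∀ {n} {I A B : Subset n} → Decomp I A B → B ⊆ I
Decomp⇒⊆ʳ {A = A} d p∈B rewrite Decomp⇒∪ d = q⊆p∪q A _ p∈B

∈-Decomp⁻ : ∀ {n} {I A B : Subset n} {p} → Decomp I A B → p ∈ I → p ∈ A ⊎ p ∈ B
∈-Decomp⁻ {A = A} {B} d p∈I rewrite Decomp⇒∪ d = x∈p∪q⁻ A B p∈I

Decomp-disjoint : ∀ {n} {I A B : Subset n} {p} → Decomp I A B → p ∈ A → p ∈ B → Empty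
Decomp-disjoint (inL ∷ d) here ()
Decomp-disjoint (_ ∷ d) (there p∈A) (there p∈B) = Decomp-disjoint d p∈A p∈B

Null-⊥ : ∀ {n} → Null (⊥ {n})
Null-⊥ {zero} = []
Null-⊥ {suc n} = _∷_ Null-⊥

Null⇒∉ : ∀ {n} {E : Subset n} {p} → Null E → p ∈ E → Empty
Null⇒∉ (_∷_ e) (there p∈E) = Null⇒∉ e p∈E

Null⊎Nonempty : ∀ {n} (A : Subset n) → Null A ⊎ Nonempty A
Null⊎Nonempty [] = inj₁ []
Null⊎Nonempty (true ∷ A) = inj₂ (_ , here)
Null⊎Nonempty (false ∷ A) with Null⊎Nonempty A
... | inj₁ e = inj₁ (_∷_ e)
... | inj₂ (p , p∈A) = inj₂ (_ , there p∈A)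

Decomp-⊥ʳ : ∀ {n} (A : Subset n) → Decomp A A ⊥
Decomp-⊥ʳ [] = []
Decomp-⊥ʳ (true ∷ A) = inL ∷ Decomp-⊥ʳ A
Decomp-⊥ʳ (false ∷ A) = out ∷ Decomp-⊥ʳ A

Decomp-⊥ˡ : ∀ {n} (A : Subset n) → Decomp A ⊥ A
Decomp-⊥ˡ A = Decomp-sym (Decomp-⊥ʳ A)

-- I = A ⊔ B and I = S ⊔ T meet in I = (A ∩ S) ⊔ (A ∩ T) ⊔ (B ∩ S) ⊔ (B ∩ T).
record CommonRefinement {n} (A B S T : Subset n) : Set where
  constructor mkCommonRefinement
  field
    {AS AT BS BT} : Subset n
    dA : Decomp A AS AT
    dB : Decomp B BS BT
    dS : Decomp S AS BS
    dT : Decomp T AT BT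

commonRefinement : ∀ {n} {I A B S T : Subset n} → Decomp I A B → Decomp I S T → CommonRefinement A B S T
commonRefinement [] [] = mkCommonRefinement [] [] [] []
commonRefinement (x ∷ d) (y ∷ e) with commonRefinement d e
commonRefinement (inL ∷ d) (inL ∷ e) | mkCommonRefinement dA dB dS dT =
  mkCommonRefinement (inL ∷ dA) (out ∷ dB) (inL ∷ dS) (out ∷ dT)
commonRefinement (inL ∷ d) (inR ∷ e) | mkCommonRefinement dA dB dS dT =
  mkCommonRefinement (inR ∷ dA) (out ∷ dB) (out ∷ dS) (inL ∷ dT)
commonRefinement (inR ∷ d) (inL ∷ e) | mkCommonRefinement dA dB dS dT =
  mkCommonRefinement (out ∷ dA) (inL ∷ dB) (inR ∷ dS) (out ∷ dT)
commonRefinement (inR ∷ d) (inR ∷ e) | mkCommonRefinement dA dB dS dT =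
  mkCommonRefinement (out ∷ dA) (inR ∷ dB) (out ∷ dS) (inR ∷ dT)
commonRefinement (out ∷ d) (out ∷ e) | mkCommonRefinement dA dB dS dT =
  mkCommonRefinement (out ∷ dA) (out ∷ dB) (out ∷ dS) (out ∷ dT)

record Reassocʳ {n} (I A B C : Subset n) : Set where
  constructor mkReassocʳ
  field
    {BC} : Subset n
    d₁ : Decomp I A BC
    d₂ : Decomp BC B C

reassocʳ : ∀ {n} {I AB A B C : Subset n} → Decomp I AB C → Decomp AB A B → Reassocʳ I A B C
reassocʳ [] [] = mkReassocʳ [] []
reassocʳ (x ∷ d) (y ∷ e) with reassocʳ d e
reassocʳ (inL ∷ d) (inL ∷ e) | mkReassocʳ d₁ d₂ = mkReassocʳ (inL ∷ d₁) (out ∷ d₂)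
reassocʳ (inL ∷ d) (inR ∷ e) | mkReassocʳ d₁ d₂ = mkReassocʳ (inR ∷ d₁) (inL ∷ d₂)
reassocʳ (inR ∷ d) (out ∷ e) | mkReassocʳ d₁ d₂ = mkReassocʳ (inR ∷ d₁) (inR ∷ d₂)
reassocʳ (out ∷ d) (out ∷ e) | mkReassocʳ d₁ d₂ = mkReassocʳ (out ∷ d₁) (out ∷ d₂)

record Reassocˡ {n} (I A B C : Subset n) : Set where
  constructor mkReassocˡ
  field
    {AB} : Subset n
    d₃ : Decomp I AB C
    d₄ : Decomp AB A B

reassocˡ : ∀ {n} {I A BC B C : Subset n} → Decomp I A BC → Decomp BC B C → Reassocˡ I A B C
reassocˡ [] [] = mkReassocˡ [] []
reassocˡ (x ∷ d) (y ∷ e) with reassocˡ d e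
reassocˡ (inL ∷ d) (out ∷ e) | mkReassocˡ d₃ d₄ = mkReassocˡ (inL ∷ d₃) (inL ∷ d₄)
reassocˡ (inR ∷ d) (inL ∷ e) | mkReassocˡ d₃ d₄ = mkReassocˡ (inL ∷ d₃) (inR ∷ d₄)
reassocˡ (inR ∷ d) (inR ∷ e) | mkReassocˡ d₃ d₄ = mkReassocˡ (inR ∷ d₃) (out ∷ d₄)
reassocˡ (out ∷ d) (out ∷ e) | mkReassocˡ d₃ d₄ = mkReassocˡ (out ∷ d₃) (out ∷ d₄)

-- Set compositions and refinement

SetComp-part⊆ : ∀ {n} {I : Subset n} {As A} → IsSetComp I As → A ∈ₗ As → A ⊆ I
SetComp-part⊆ (cons d _ s) (here refl) = Decomp⇒⊆ˡ d
SetComp-part⊆ (cons d _ s) (there A∈As) = Decomp⇒⊆ʳ d ∘′ SetComp-part⊆ s A∈As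

SetComp-cover : ∀ {n} {I : Subset n} {As p} → IsSetComp I As → p ∈ I → ∃ λ A → A ∈ₗ As × p ∈ A
SetComp-cover (nil e) p∈I = ⊥-elim (Null⇒∉ e p∈I)
SetComp-cover (cons d _ s) p∈I with ∈-Decomp⁻ d p∈I
... | inj₁ p∈A = _ , here refl , p∈A
... | inj₂ p∈J with SetComp-cover s p∈J
... | A , A∈As , p∈A = A , there A∈As , p∈A

SetComp-unique : ∀ {n} {I : Subset n} {As} → IsSetComp I As → Unique As
SetComp-unique (nil _) = []
SetComp-unique (cons d (p , p∈A) s) =
  tabulate (λ A'∈As A≡A' → Decomp-disjoint d p∈A (SetComp-part⊆ s A'∈As (subst (p ∈_) A≡A' p∈A)))
  ∷ SetComp-unique s

Refines-refl : ∀ {n} (As : List (Subset n)) → Refines As As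
Refines-refl [] = []
Refines-refl (A ∷ As) = grp (sym (∪-identityʳ A)) (Refines-refl As)

length≤length-++ : ∀ {A : Set} (xs ys : List A) → length ys ≤ length (xs ++ ys)
length≤length-++ xs ys = ≤-trans (m≤n+m _ (length xs)) (≤-reflexive (sym (length-++ xs)))

Refines⇒length≤ : ∀ {n} {Bs As : List (Subset n)} → Refines Bs As → length As ≤ length Bs
Refines⇒length≤ [] = z≤n
Refines⇒length≤ (grp {Cs = Cs} {As = Bs} _ r) = s≤s (≤-trans (Refines⇒length≤ r) (length≤length-++ Cs Bs))

Refines∧length≡⇒≡ : ∀ {n} {Bs As : List (Subset n)} → Refines Bs As → length Bs ≡ length As → Bs ≡ As
Refines∧length≡⇒≡ [] _ = refl
Refines∧length≡⇒≡ (grp {C = C} {[]} eq r) len =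
  cong₂ _∷_ (sym (trans eq (∪-identityʳ C))) (Refines∧length≡⇒≡ r (suc-injective len))
Refines∧length≡⇒≡ (grp {Cs = _ ∷ Cs} {As = Bs} _ r) len =
  ⊥-elim (1+n≰n (subst (_≤ length (Cs ++ Bs)) (sym (suc-injective len))
    (≤-trans (Refines⇒length≤ r) (length≤length-++ Cs Bs))))

Refines-resp-↭ : ∀ {n} {As Λ Bs : List (Subset n)} → As ↭ Λ → Refines Bs As →
  ∃ λ Bs' → Bs ↭ Bs' × Refines Bs' Λ
Refines-resp-↭ refl r = _ , refl , r
Refines-resp-↭ (prep _ p) (grp {C = C} {Cs} eq r) with Bs' , q , r' ← Refines-resp-↭ p r =
  (C ∷ Cs) ++ Bs' , ++⁺ˡ (C ∷ Cs) q , grp eq r'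
Refines-resp-↭ (swap _ _ p) (grp {C = C₁} {Cs₁} eq₁ (grp {C = C₂} {Cs₂} eq₂ r))
  with Bs' , q , r' ← Refines-resp-↭ p r =
  (C₂ ∷ Cs₂) ++ (C₁ ∷ Cs₁) ++ Bs' ,
  ↭-trans (++⁺ˡ (C₁ ∷ Cs₁) (++⁺ˡ (C₂ ∷ Cs₂) q)) (shifts (C₁ ∷ Cs₁) (C₂ ∷ Cs₂)) ,
  grp eq₂ (grp eq₁ r')
Refines-resp-↭ (↭-trans p q) r
  with Bs₁ , q₁ , r₁ ← Refines-resp-↭ p r
  with Bs₂ , q₂ , r₂ ← Refines-resp-↭ q r₁
  = Bs₂ , ↭-trans q₁ q₂ , r₂

∈⇒↭-head : ∀ {A : Set} {x : A} {xs} → x ∈ₗ xs → ∃ λ ys → xs ↭ x ∷ ys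
∈⇒↭-head {x = x} x∈xs with ys , zs , refl ← ∈-∃++ x∈xs = ys ++ zs , shift x ys zs

>>=-just⁻ : ∀ {A B : Set} (m : Maybe A) (f : A → Maybe B) {z} → (m >>= f) ≡ just z →
  ∃ λ a → m ≡ just a × f a ≡ just z
>>=-just⁻ (just a) f eq = a , refl , eq

map-just⁻ : ∀ {A B : Set} (m : Maybe A) (f : A → B) {z} → mapM f m ≡ just z →
  ∃ λ a → m ≡ just a × f a ≡ z
map-just⁻ (just a) f refl = a , refl , refl

-- Linearized Hopf monoids

module _ {n : ℕ} (H : LinHopf n) where
  open LinHopf H

  cop∘mu : ∀ {I A B : Subset n} (d : Decomp I A B) a b → cop d (mu d a b) ≡ just (a , b)
  cop∘mu {A = A} {B} d a b
    rewrite compat d d (Decomp-⊥ʳ A) (Decomp-⊥ˡ B) (Decomp-⊥ʳ A) (Decomp-⊥ˡ B) a b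
          | counitʳ Null-⊥ (Decomp-⊥ʳ A) a | counitˡ Null-⊥ (Decomp-⊥ˡ B) b
          | unitʳ Null-⊥ (Decomp-⊥ʳ A) a | unitˡ Null-⊥ (Decomp-⊥ˡ B) b = refl

  cop∘mu-interchange : ∀ {I A B S T AS AT BS BT : Subset n}
    (dAB : Decomp I A B) (dST : Decomp I S T)
    (dA : Decomp A AS AT) (dB : Decomp B BS BT) (dS : Decomp S AS BS) (dT : Decomp T AT BT)
    a₁ a₂ b₁ b₂ →
    cop dST (mu dAB (mu dA a₁ a₂) (mu dB b₁ b₂)) ≡ just (mu dS a₁ b₁ , mu dT a₂ b₂)
  cop∘mu-interchange dAB dST dA dB dS dT a₁ a₂ b₁ b₂
    rewrite compat dAB dST dA dB dS dT (mu dA a₁ a₂) (mu dB b₁ b₂)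
          | cop∘mu dA a₁ a₂ | cop∘mu dB b₁ b₂ = refl

  coassoc-justʳ : ∀ {I A B C AB BC}
    (d₁ : Decomp I A BC) (d₂ : Decomp BC B C) (d₃ : Decomp I AB C) (d₄ : Decomp AB A B)
    {x a b c ab} → cop d₃ x ≡ just (ab , c) → cop d₄ ab ≡ just (a , b) →
    ∃ λ bc → cop d₁ x ≡ just (a , bc) × cop d₂ bc ≡ just (b , c)
  coassoc-justʳ d₁ d₂ d₃ d₄ {x} c₃ c₄ with coassoc d₁ d₂ d₃ d₄ x
  ... | eq rewrite c₃ | c₄
    with (_ , bc) , c₁ , r ← >>=-just⁻ (cop d₁ x) _ eq
    with _ , c₂ , refl ← map-just⁻ (cop d₂ bc) _ r
    = bc , c₁ , c₂

  coassoc-justˡ : ∀ {I A B C AB BC}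
    (d₁ : Decomp I A BC) (d₂ : Decomp BC B C) (d₃ : Decomp I AB C) (d₄ : Decomp AB A B)
    {x a b c bc} → cop d₁ x ≡ just (a , bc) → cop d₂ bc ≡ just (b , c) →
    ∃ λ ab → cop d₃ x ≡ just (ab , c) × cop d₄ ab ≡ just (a , b)
  coassoc-justˡ d₁ d₂ d₃ d₄ {x} c₁ c₂ with coassoc d₁ d₂ d₃ d₄ x
  ... | eq rewrite c₁ | c₂
    with (ab , _) , c₃ , r ← >>=-just⁻ (cop d₃ x) _ (sym eq)
    with _ , c₄ , refl ← map-just⁻ (cop d₄ ab) _ r
    = ab , c₃ , c₄

  cop-swap : ∀ {I X Y J K J' M : Subset n}
    (d₁ : Decomp I Y J) (d₂ : Decomp J X K) (d₃ : Decomp I M K) (d₄ : Decomp M Y X)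
    (e₁ : Decomp I X J') (e₂ : Decomp J' Y K) {z zY zJ zX zK} →
    cop d₁ z ≡ just (zY , zJ) → cop d₂ zJ ≡ just (zX , zK) →
    ∃ λ w → cop e₁ z ≡ just (zX , w) × cop e₂ w ≡ just (zY , zK)
  cop-swap d₁ d₂ d₃ d₄ e₁ e₂ c₁ c₂
    with m , c₃ , c₄ ← coassoc-justˡ d₁ d₂ d₃ d₄ c₁ c₂
    = coassoc-justʳ e₁ e₂ d₃ (Decomp-sym d₄) c₃
        (trans (cocomm d₄ (Decomp-sym d₄) m) (cong (mapM _) c₄))

  mu-swap : ∀ {I X Y J K J' M : Subset n}
    (d₁ : Decomp I Y J) (d₂ : Decomp J X K) (d₃ : Decomp I M K) (d₄ : Decomp M Y X)
    (e₁ : Decomp I X J') (e₂ : Decomp J' Y K) a b c →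
    mu e₁ a (mu e₂ b c) ≡ mu d₁ b (mu d₂ a c)
  mu-swap d₁ d₂ d₃ d₄ e₁ e₂ a b c = begin
    mu e₁ a (mu e₂ b c)              ≡⟨ assoc e₁ e₂ d₃ (Decomp-sym d₄) a b c ⟩
    mu d₃ (mu (Decomp-sym d₄) a b) c ≡⟨ cong (λ w → mu d₃ w c) (comm (Decomp-sym d₄) d₄ a b) ⟩
    mu d₃ (mu d₄ b a) c              ≡⟨ assoc d₁ d₂ d₃ d₄ b a c ⟨
    mu d₁ b (mu d₂ a c)              ∎
    where open ≡-Reasoning

  copIt-cons⁻ : ∀ {I A J As} (d : Decomp I A J) (ne : Nonempty A) (s : IsSetComp J As) {x t} →
    copIt H (cons d ne s) x ≡ just t →
    ∃₂ λ a xJ → ∃ λ tJ → cop d x ≡ just (a , xJ) × copIt H s xJ ≡ just tJ × t ≡ a ∷ tJ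
  copIt-cons⁻ d ne s {x} eq
    with (a , xJ) , c , r ← >>=-just⁻ (cop d x) _ eq
    with tJ , cJ , refl ← map-just⁻ (copIt H s xJ) _ r
    = a , xJ , tJ , c , cJ , refl

  copIt-cons⁺ : ∀ {I A J As} (d : Decomp I A J) (ne : Nonempty A) (s : IsSetComp J As) {x a xJ tJ} →
    cop d x ≡ just (a , xJ) → copIt H s xJ ≡ just tJ → copIt H (cons d ne s) x ≡ just (a ∷ tJ)
  copIt-cons⁺ d ne s c cJ rewrite c | cJ = refl

  Simulates : ∀ {I As Bs} → IsSetComp I As → IsSetComp I Bs → Set
  Simulates s' s = ∀ {x t} → copIt H s x ≡ just t →
    ∃ λ t' → copIt H s' x ≡ just t' × muIt H s' t' ≡ muIt H s t

  Simulates-cons : ∀ {I A J As Bs} (d : Decomp I A J) (ne : Nonempty A)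
    {s' : IsSetComp J As} {s : IsSetComp J Bs} →
    Simulates s' s → Simulates (cons d ne s') (cons d ne s)
  Simulates-cons d ne {s'} {s} sim eq
    with a , xJ , tJ , c , cJ , refl ← copIt-cons⁻ d ne s eq
    with tJ' , cJ' , μ≡ ← sim cJ
    = a ∷ tJ' , copIt-cons⁺ d ne s' c cJ' , cong (mu d a) μ≡

  Simulates-swap : ∀ {I X Y J K J' M As Bs}
    (d₁ : Decomp I Y J) (d₂ : Decomp J X K) (d₃ : Decomp I M K) (d₄ : Decomp M Y X)
    (e₁ : Decomp I X J') (e₂ : Decomp J' Y K) (neX : Nonempty X) (neY : Nonempty Y)
    {s' : IsSetComp K As} {s : IsSetComp K Bs} → Simulates s' s →
    Simulates (cons e₁ neX (cons e₂ neY s')) (cons d₁ neY (cons d₂ neX s))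
  Simulates-swap d₁ d₂ d₃ d₄ e₁ e₂ neX neY {s'} {s} sim eq
    with zY , zJ , _ , c₁ , cJ , refl ← copIt-cons⁻ d₁ neY (cons d₂ neX s) eq
    with zX , zK , t , c₂ , cK , refl ← copIt-cons⁻ d₂ neX s cJ
    with t' , cK' , μ≡ ← sim cK
    with w , c₁' , c₂' ← cop-swap d₁ d₂ d₃ d₄ e₁ e₂ c₁ c₂
    = zX ∷ zY ∷ t'
    , copIt-cons⁺ e₁ neX (cons e₂ neY s') c₁' (copIt-cons⁺ e₂ neY s' c₂' cK')
    , trans (cong (λ r → mu e₁ zX (mu e₂ zY r)) μ≡) (mu-swap d₁ d₂ d₃ d₄ e₁ e₂ zX zY _)

  Simulates-trans : ∀ {I As Bs Cs} {s₂ : IsSetComp I As} {s₁ : IsSetComp I Bs} {s : IsSetComp I Cs} →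
    Simulates s₂ s₁ → Simulates s₁ s → Simulates s₂ s
  Simulates-trans sim₂ sim₁ eq
    with t₁ , c₁ , μ₁ ← sim₁ eq
    with t₂ , c₂ , μ₂ ← sim₂ c₁
    = t₂ , c₂ , trans μ₂ μ₁

  ↭-Simulates : ∀ {I As Bs} → As ↭ Bs → (s : IsSetComp I Bs) → Σ (IsSetComp I As) λ s' → Simulates s' s
  ↭-Simulates refl s = s , λ eq → _ , eq , refl
  ↭-Simulates (prep _ p) (cons d ne s) with s' , sim ← ↭-Simulates p s =
    cons d ne s' , Simulates-cons d ne sim
  ↭-Simulates (swap _ _ p) (cons d₁ neY (cons d₂ neX s))
    with s' , sim ← ↭-Simulates p s
    with mkReassocˡ d₃ d₄ ← reassocˡ d₁ d₂
    with mkReassocʳ e₁ e₂ ← reassocʳ d₃ (Decomp-sym d₄)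
    = cons e₁ neX (cons e₂ neY s') , Simulates-swap d₁ d₂ d₃ d₄ e₁ e₂ neX neY sim
  ↭-Simulates (↭-trans p q) s
    with s₁ , sim₁ ← ↭-Simulates q s
    with s₂ , sim₂ ← ↭-Simulates p s₁
    = s₂ , Simulates-trans {s₂ = s₂} {s₁} {s} sim₂ sim₁

  InC-resp-↭ : ∀ {I} {x y : h I} {As Bs} → As ↭ Bs → InC H x y Bs → InC H x y As
  InC-resp-↭ p (s , t , c , μ≡)
    with s' , sim ← ↭-Simulates p s
    with t' , c' , μ≡' ← sim c
    = s' , t' , c' , trans μ≡' μ≡

  -- Minimal elements of C_x^y

  Minimal-resp-↭ : ∀ {I} {x y : h I} {Λ As} → Minimal H x y Λ → As ↭ Λ → Minimal H x y As
  Minimal-resp-↭ {x = x} {y} {Λ} {As} (Λ∈C , Λ-minimal) As↭Λ = InC-resp-↭ As↭Λ Λ∈C , As-minimal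
    where
    As-minimal : ∀ Bs → InC H x y Bs → Refines Bs As → Bs ≡ As
    As-minimal Bs Bs∈C Bs≤As with Bs' , Bs↭Bs' , Bs'≤Λ ← Refines-resp-↭ As↭Λ Bs≤As =
      Refines∧length≡⇒≡ Bs≤As (begin
        length Bs  ≡⟨ ↭-length Bs↭Bs' ⟩
        length Bs' ≡⟨ cong length (Λ-minimal Bs' (InC-resp-↭ (↭-sym Bs↭Bs') Bs∈C) Bs'≤Λ) ⟩
        length Λ   ≡⟨ ↭-length As↭Λ ⟨
        length As  ∎)
      where open ≡-Reasoning

  mu-head-factors : ∀ {I B J C K BC BK JC JK : Subset n}
    (d : Decomp I B J) (e : Decomp I C K)
    (dB : Decomp B BC BK) (dJ : Decomp J JC JK) (dC : Decomp C BC JC) (dK : Decomp K BK JK)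
    {b yJ c yK} → mu d b yJ ≡ mu e c yK →
    ∃₂ λ u v → cop dB b ≡ just (u , v) × mu dB u v ≡ b
  mu-head-factors d e dB dJ dC dK {b} {yJ} {c} {yK} μ≡
    with (u , v) , cB , r ← >>=-just⁻ (cop dB b) _
           (trans (sym (compat d e dB dJ dC dK b yJ)) (trans (cong (cop e) μ≡) (cop∘mu e c yK)))
    with (p , q) , _ , r' ← >>=-just⁻ (cop dJ yJ) _ r
    = u , v , cB , cong proj₁ (just-injective (begin
        just (mu dB u v , mu dJ p q)         ≡⟨ cop∘mu-interchange e d dC dK dB dJ u p v q ⟨
        cop d (mu e (mu dC u p) (mu dK v q)) ≡⟨ cong (cop d) (cong₂ (mu e) c≡ yK≡) ⟩
        cop d (mu e c yK)                    ≡⟨ cong (cop d) μ≡ ⟨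
        cop d (mu d b yJ)                    ≡⟨ cop∘mu d b yJ ⟩
        just (b , yJ)                        ∎))
    where
    open ≡-Reasoning
    c≡ : mu dC u p ≡ c
    c≡ = cong proj₁ (just-injective r')
    yK≡ : mu dK v q ≡ yK
    yK≡ = cong proj₂ (just-injective r')

  InC-split-head : ∀ {I B J BC BK Bs} {x y : h I}
    (d : Decomp I B J) (s : IsSetComp J Bs) (dB : Decomp B BC BK) →
    Nonempty BC → Nonempty BK → ∀ {b xJ t u v} →
    cop d x ≡ just (b , xJ) → copIt H s xJ ≡ just t → mu d b (muIt H s t) ≡ y →
    cop dB b ≡ just (u , v) → mu dB u v ≡ b →
    InC H x y (BC ∷ BK ∷ Bs)
  InC-split-head d s dB neBC neBK {b} {t = t} {u} {v} cd cs μ≡ cB b≡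
    with mkReassocʳ d₁ d₂ ← reassocʳ d dB
    with _ , c₁ , c₂ ← coassoc-justʳ d₁ d₂ d dB cd cB
    = cons d₁ neBC (cons d₂ neBK s) , u ∷ v ∷ t
    , copIt-cons⁺ d₁ neBC (cons d₂ neBK s) c₁ (copIt-cons⁺ d₂ neBK s c₂ cs)
    , (begin
        mu d₁ u (mu d₂ v (muIt H s t)) ≡⟨ assoc d₁ d₂ d dB u v _ ⟩
        mu d (mu dB u v) (muIt H s t)  ≡⟨ cong (λ b' → mu d b' (muIt H s t)) b≡ ⟩
        mu d b (muIt H s t)            ≡⟨ μ≡ ⟩
        _                              ∎)
    where open ≡-Reasoning

  -- Otherwise splitting B into B ∩ C and B ∖ C gives a strictly finer element of C_x^y.
  Minimal-head-⊆ : ∀ {I} {x y : h I} {B C Bs Cs p} →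
    Minimal H x y (B ∷ Bs) → InC H x y (C ∷ Cs) → p ∈ B → p ∈ C → B ⊆ C
  Minimal-head-⊆ {Bs = Bs} ((cons d neB s , _ , cx , μ≡) , minimal) (cons e neC s' , _ , cx' , μ≡') p∈B p∈C
    with b , _ , t , cd , cs , refl ← copIt-cons⁻ d neB s cx
    with _ , _ , _ , _ , _ , refl ← copIt-cons⁻ e neC s' cx'
    with mkCommonRefinement {BC} {BK} dB dJ dC dK ← commonRefinement d e
    with u , v , cB , b≡ ← mu-head-factors d e dB dJ dC dK (trans μ≡ (sym μ≡'))
    with Null⊎Nonempty BK
  ... | inj₁ B∖C-null = [ Decomp⇒⊆ˡ dC , (λ q∈B∖C → ⊥-elim (Null⇒∉ B∖C-null q∈B∖C)) ]′ ∘′ ∈-Decomp⁻ dB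
  ... | inj₂ neBK = ⊥-elim (1+n≢n (cong length (∷-injectiveʳ (minimal _ split-∈C split-refines))))
    where
    neBC : Nonempty BC
    neBC with ∈-Decomp⁻ dB p∈B
    ... | inj₁ p∈BC = _ , p∈BC
    ... | inj₂ p∈BK = ⊥-elim (Decomp-disjoint e p∈C (Decomp⇒⊆ˡ dK p∈BK))
    split-∈C : InC H _ _ (BC ∷ BK ∷ Bs)
    split-∈C = InC-split-head d s dB neBC neBK cd cs μ≡ cB b≡
    split-refines : Refines (BC ∷ BK ∷ Bs) (_ ∷ Bs)
    split-refines = grp (trans (Decomp⇒∪ dB) (cong (BC ∪_) (sym (∪-identityʳ BK)))) (Refines-refl Bs)

  Minimal-parts-⊆ : ∀ {I} {x y : h I} {As Λ} →
    Minimal H x y As → Minimal H x y Λ → ∀ {L} → L ∈ₗ Λ → L ∈ₗ As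
  Minimal-parts-⊆ As-min Λ-min L∈Λ
    with Λ' , Λ↭ ← ∈⇒↭-head L∈Λ
    with LΛ'-min ← Minimal-resp-↭ Λ-min (↭-sym Λ↭)
    with (cons e (p , p∈L) _ , _) , _ ← LΛ'-min
    with A , A∈As , p∈A ← SetComp-cover (proj₁ (proj₁ As-min)) (Decomp⇒⊆ˡ e p∈L)
    with As' , As↭ ← ∈⇒↭-head A∈As
    with AAs'-min ← Minimal-resp-↭ As-min (↭-sym As↭)
    = subst (_∈ₗ _) (⊆-antisym (Minimal-head-⊆ AAs'-min (proj₁ LΛ'-min) p∈A p∈L)
                               (Minimal-head-⊆ LΛ'-min (proj₁ AAs'-min) p∈L p∈A)) A∈As

  Minimal⇒↭ : ∀ {I} {x y : h I} {As Λ} → Minimal H x y As → Minimal H x y Λ → As ↭ Λ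
  Minimal⇒↭ As-min Λ-min =
    ∼bag⇒↭ (unique∧set⇒bag (SetComp-unique (proj₁ (proj₁ As-min))) (SetComp-unique (proj₁ (proj₁ Λ-min)))
      (mk⇔ (Minimal-parts-⊆ Λ-min As-min) (Minimal-parts-⊆ As-min Λ-min)))

lemma3p3 : ∀ {n} (H : LinHopf n) (I : Subset n) (x y : LinHopf.h H I) →
    (∀ (As Λ : List (Subset n)) → Minimal H x y As → Minimal H x y Λ → As ↭ Λ)
    × (∀ (Λ As : List (Subset n)) → Minimal H x y Λ → As ↭ Λ → Minimal H x y As)
lemma3p3 H I x y = (λ _ _ → Minimal⇒↭ H) , (λ _ _ → Minimal-resp-↭ H)
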